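{- Let $k \geq 1$ be an integer and let $E_k = \gcd(2^k-1, k)$. Then there exist a positive integer $W(k)$ and a number $N_0(k)$ such that every multiple $N$ of $E_k$ with $N > N_0(k)$ can be written as a sum of at most $W(k)$ binary $k$'th powers.
   Context: For integers $k,n \geq 1$ let $c_k(n) := \frac{2^{kn}-1}{2^n-1} = 1 + 2^n + \cdots + 2^{(k-1)n}$. A natural number is a binary $k$'th power if its canonical binary representation (no leading zeros) consists of $k$ consecutive identical blocks; equivalently, it is $0$ or of the form $a \cdot c_k(n)$ with $n \geq 1$ and $2^{n-1} \leq a < 2^n$. Sums may use the same binary $k$'th power several times. -}

module Defs where

open import Data.Nat using (ℕ; zero; suc; _+_; _*_; _^_; _≤_; _<_)
open import Data.Nat.GCD using (gcd)
open import Data.Nat using (_∸_)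
open import Data.Product using (Σ; ∃; _×_)
open import Data.Sum using (_⊎_)
open import Data.List using (List; length)
open import Data.Nat.ListAction using (sum)
open import Data.List.Relation.Unary.All using (All)
open import Relation.Binary.PropositionalEquality using (_≡_)

-- c k n = 1 + 2^n + ... + 2^((k-1) n)
c : ℕ → ℕ → ℕ
c zero n = 0
c (suc k) n = 1 + 2 ^ n * c k n

E : ℕ → ℕ
E k = gcd (2 ^ k ∸ 1) k

BinPow : ℕ → ℕ → Set
BinPow k x = (x ≡ 0) ⊎
  (Σ ℕ λ n → Σ ℕ λ a → 1 ≤ n × 2 ^ (n ∸ 1) ≤ a × a < 2 ^ n × x ≡ a * c k n)

SumOfAtMost : ℕ → ℕ → ℕ → Set
SumOfAtMost k W N = Σ (List ℕ) λ xs → All (BinPow k) xs × length xs ≤ W × sum xs ≡ N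

{-# OPTIONS --safe #-}
-- For large N in a suitable window, N is written as Σ_{i ≤ k} m_i c_k(n + i) with
-- 2^(n+i-1) ≤ m_i ≤ J 2^(n+i-1); each term then splits into at most J binary k'th powers
-- a c_k(n + i) with 2^(n+i-1) ≤ a < 2^(n+i).  The level n is a multiple of a period of 2 modulo
-- Q = |∏_{1 ≤ e < k} (1 - 2^e)|, so c_k(n) ≡ k and c_k(n + 1) ≡ 2^k - 1 (mod Q); by Bézout for
-- E_k = gcd(2^k - 1, k), bulk coefficients of size ≈ 2^(n+i) can be chosen so that the
-- remainder D < Q c_k(n) is divisible by Q.  Since c_k(m) = Σ_{e<k} 2^(e m), the polynomial
-- ∏_{e′ ≠ e} (y - 2^e′) gives a combination of c_k(n), …, c_k(n + k), with coefficients
-- independent of n, of value G_e 2^(e n) with G_e ≠ 0.  Expanding D greedily in the mixed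
-- radix of these values absorbs it with corrections O(2^n) to the bulk coefficients.
module Submission where

open import Defs
import Data.Nat

module FiniteSums where
  open import Data.Nat as ℕ using (ℕ; zero; suc)
  import Data.Nat.Properties as ℕ
  open import Data.Fin using (Fin; zero; suc; toℕ)
  open import Data.Fin.Properties using (toℕ<n)
  open import Data.Integer using (ℤ; +_; ∣_∣; _+_; 0ℤ)
  open import Data.Integer.Properties using (+-*-semiring; pos-+; ∣i+j∣≤∣i∣+∣j∣; +-identityˡ; +-identityʳ)
  open import Function using (_∘_)
  open import Relation.Binary.PropositionalEquality
  import Algebra.Properties.Semiring.Sum as Sum

  module ℕΣ = Sum ℕ.+-*-semiring
  module ℤΣ = Sum +-*-semiring
  open ℤΣ public using (sum-syntax)

  ∑ℕ-syntax : ∀ n → (Fin n → ℕ) → ℕ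
  ∑ℕ-syntax = ℕΣ.sum-syntax
  syntax ∑ℕ-syntax n (λ i → x) = ∑ℕ[ i < n ] x

  ∑-mono-≤ : ∀ {n} {f g : Fin n → ℕ} → (∀ i → f i ℕ.≤ g i) → ∑ℕ[ i < n ] f i ℕ.≤ ∑ℕ[ i < n ] g i
  ∑-mono-≤ {zero} f≤g = ℕ.z≤n
  ∑-mono-≤ {suc n} f≤g = ℕ.+-mono-≤ (f≤g zero) (∑-mono-≤ (f≤g ∘ suc))

  ∑-≤-* : ∀ {n a} {f : Fin n → ℕ} → (∀ i → f i ℕ.≤ a) → ∑ℕ[ i < n ] f i ℕ.≤ n ℕ.* a
  ∑-≤-* {zero} f≤a = ℕ.z≤n
  ∑-≤-* {suc n} f≤a = ℕ.+-mono-≤ (f≤a zero) (∑-≤-* (f≤a ∘ suc))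

  ≤-∑ : ∀ {n} (f : Fin n → ℕ) i → f i ℕ.≤ ∑ℕ[ j < n ] f j
  ≤-∑ f zero = ℕ.m≤m+n _ _
  ≤-∑ f (suc i) = ℕ.≤-trans (≤-∑ (f ∘ suc) i) (ℕ.m≤n+m _ (f zero))

  pos-∑ : ∀ {n} (f : Fin n → ℕ) → + (∑ℕ[ i < n ] f i) ≡ ∑[ i < n ] (+ f i)
  pos-∑ {zero} f = refl
  pos-∑ {suc n} f = trans (pos-+ (f zero) _) (cong (_+_ (+ f zero)) (pos-∑ (f ∘ suc)))

  ∣∑∣≤∑∣∣ : ∀ {n} (f : Fin n → ℤ) → ∣ ∑[ i < n ] f i ∣ ℕ.≤ ∑ℕ[ i < n ] ∣ f i ∣
  ∣∑∣≤∑∣∣ {zero} f = ℕ.z≤n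
  ∣∑∣≤∑∣∣ {suc n} f =
    ℕ.≤-trans (∣i+j∣≤∣i∣+∣j∣ (f zero) _) (ℕ.+-monoʳ-≤ ∣ f zero ∣ (∣∑∣≤∑∣∣ (f ∘ suc)))

  ∑-pick : ∀ n (F : ℕ → ℤ) {e} → e ℕ.< n → (∀ e′ → e′ ℕ.< n → e′ ≢ e → F e′ ≡ 0ℤ) →
           ∑[ i < n ] F (toℕ i) ≡ F e
  ∑-pick (suc n) F {zero} _ others = begin
    F 0 + ∑[ i < n ] F (suc (toℕ i))  ≡⟨ cong (_+_ (F 0)) (trans (ℤΣ.sum-cong-≗ vanish) (ℤΣ.sum-replicate-zero n)) ⟩
    F 0 + 0ℤ                          ≡⟨ +-identityʳ (F 0) ⟩
    F 0                               ∎
    where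
    open ≡-Reasoning
    vanish : ∀ i → F (suc (toℕ i)) ≡ 0ℤ
    vanish i = others (suc (toℕ i)) (ℕ.s≤s (toℕ<n i)) λ ()
  ∑-pick (suc n) F {suc e} (ℕ.s≤s e<n) others = begin
    F 0 + ∑[ i < n ] F (suc (toℕ i))  ≡⟨ cong₂ _+_ (others 0 ℕ.z<s λ ()) (∑-pick n (F ∘ suc) e<n others′) ⟩
    0ℤ + F (suc e)                    ≡⟨ +-identityˡ (F (suc e)) ⟩
    F (suc e)                         ∎
    where
    open ≡-Reasoning
    others′ : ∀ e′ → e′ ℕ.< n → e′ ≢ e → F (suc e′) ≡ 0ℤ
    others′ e′ e′<n e′≢e = others (suc e′) (ℕ.s≤s e′<n) (e′≢e ∘ ℕ.suc-injective)

module SumsOfBinaryPowers (k : Data.Nat.ℕ) where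
  open import Data.Nat
  open import Data.Nat.Properties
  open import Data.Fin using (Fin; zero; suc)
  open import Data.List using ([]; _∷_; _++_)
  open import Data.List.Properties using (length-++)
  open import Data.Nat.ListAction.Properties using (sum-++)
  open import Data.List.Relation.Unary.All using ([]; _∷_)
  open import Data.List.Relation.Unary.All.Properties using (++⁺)
  open import Data.Product using (_,_)
  open import Data.Sum using (inj₂)
  open import Function using (_∘_)
  open import Relation.Binary.PropositionalEquality
  open import Relation.Nullary using (yes; no; contradiction)
  open FiniteSums using (∑ℕ-syntax)

  sumOfAtMost-zero : SumOfAtMost k 0 0
  sumOfAtMost-zero = [] , [] , z≤n , refl

  sumOfAtMost-singleton : ∀ {x} → BinPow k x → SumOfAtMost k 1 x
  sumOfAtMost-singleton {x} p = x ∷ [] , p ∷ [] , ≤-refl , +-identityʳ x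

  sumOfAtMost-+ : ∀ {V W x y} → SumOfAtMost k V x → SumOfAtMost k W y → SumOfAtMost k (V + W) (x + y)
  sumOfAtMost-+ (xs , pxs , |xs|≤V , Σxs) (ys , pys , |ys|≤W , Σys) =
    xs ++ ys , ++⁺ pxs pys , subst (_≤ _) (sym (length-++ xs)) (+-mono-≤ |xs|≤V |ys|≤W) ,
    trans (sum-++ xs ys) (cong₂ _+_ Σxs Σys)

  sumOfAtMost-mono : ∀ {V W x} → V ≤ W → SumOfAtMost k V x → SumOfAtMost k W x
  sumOfAtMost-mono V≤W (xs , pxs , |xs|≤V , Σxs) = xs , pxs , ≤-trans |xs|≤V V≤W , Σxs

  sumOfAtMost-∑ : ∀ {W} n (f : Fin n → ℕ) → (∀ i → SumOfAtMost k W (f i)) →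
                  SumOfAtMost k (n * W) (∑ℕ[ i < n ] f i)
  sumOfAtMost-∑ zero f _ = sumOfAtMost-zero
  sumOfAtMost-∑ (suc n) f sums = sumOfAtMost-+ (sums zero) (sumOfAtMost-∑ n (f ∘ suc) (sums ∘ suc))

  binPow-block : ∀ ℓ {a} → 2 ^ ℓ ≤ a → a < 2 ^ suc ℓ → BinPow k (a * c k (suc ℓ))
  binPow-block ℓ lo hi = inj₂ (suc ℓ , _ , s≤s z≤n , lo , hi , refl)

  sumOfAtMost-level : ∀ J ℓ {m} → 2 ^ ℓ ≤ m → m ≤ J * 2 ^ ℓ → SumOfAtMost k J (m * c k (suc ℓ))
  sumOfAtMost-level zero ℓ lo hi = contradiction (≤-trans lo hi) (<⇒≱ (m^n>0 2 ℓ))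
  sumOfAtMost-level (suc J) ℓ {m} lo hi with m <? 2 ^ suc ℓ
  ... | yes m<2L = sumOfAtMost-mono (s≤s z≤n) (sumOfAtMost-singleton (binPow-block ℓ lo m<2L))
  ... | no m≮2L = subst (SumOfAtMost k (suc J)) split
        (sumOfAtMost-+ (sumOfAtMost-singleton (binPow-block ℓ ≤-refl L<2L))
                       (sumOfAtMost-level J ℓ L≤m∸L m∸L≤JL))
    where
    L = 2 ^ ℓ
    L<2L : L < 2 ^ suc ℓ
    L<2L = ^-monoʳ-< 2 (s≤s (s≤s z≤n)) (n<1+n ℓ)
    L≤m∸L : L ≤ m ∸ L
    L≤m∸L = m+n≤o⇒m≤o∸n L (subst (_≤ m) (cong (L +_) (+-identityʳ L)) (≮⇒≥ m≮2L))
    m∸L≤JL : m ∸ L ≤ J * L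
    m∸L≤JL = subst (m ∸ L ≤_) (m+n∸m≡n L (J * L)) (∸-monoˡ-≤ L hi)
    split : L * c k (suc ℓ) + (m ∸ L) * c k (suc ℓ) ≡ m * c k (suc ℓ)
    split = trans (sym (*-distribʳ-+ (c k (suc ℓ)) L (m ∸ L))) (cong (_* c k (suc ℓ)) (m+[n∸m]≡n lo))

module Congruences where
  open import Data.Nat as ℕ using (ℕ)
  open import Data.Fin using (Fin; zero; suc)
  open import Data.Integer hiding (suc)
  open import Data.Integer.Properties
  open import Data.Integer.Divisibility.Signed
  open import Data.Integer.DivMod using (_%ℕ_; _/ℕ_; a≡a%ℕn+[a/ℕn]*n)
  open import Data.Integer.Tactic.RingSolver using (solve-∀)
  open import Function using (_∘_)
  open import Level using (0ℓ)
  open import Relation.Binary.Bundles using (Setoid)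
  open import Relation.Binary.PropositionalEquality
  open FiniteSums using (sum-syntax)

  infix 4 _≡_[mod_]
  record _≡_[mod_] (a b m : ℤ) : Set where
    constructor mod-via
    field ∣-difference : m ∣ a - b
  open _≡_[mod_] public

  module _ {m : ℤ} where

    ≡-mod-reflexive : ∀ {a b} → a ≡ b → a ≡ b [mod m ]
    ≡-mod-reflexive {a} refl = mod-via (divides 0ℤ (trans (+-inverseʳ a) (sym (*-zeroˡ m))))

    ≡-mod-sym : ∀ {a b} → a ≡ b [mod m ] → b ≡ a [mod m ]
    ≡-mod-sym {a} {b} (mod-via m∣a-b) = mod-via (subst (m ∣_) (lemma a b) (∣m⇒∣-m m∣a-b))
      where
      lemma : ∀ a b → - (a - b) ≡ b - a
      lemma = solve-∀

    ≡-mod-trans : ∀ {a b c} → a ≡ b [mod m ] → b ≡ c [mod m ] → a ≡ c [mod m ]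
    ≡-mod-trans {a} {b} {c} (mod-via m∣a-b) (mod-via m∣b-c) =
      mod-via (subst (m ∣_) (lemma a b c) (∣m∣n⇒∣m+n m∣a-b m∣b-c))
      where
      lemma : ∀ a b c → a - b + (b - c) ≡ a - c
      lemma = solve-∀

    ≡-mod-+ : ∀ {a b c d} → a ≡ b [mod m ] → c ≡ d [mod m ] → a + c ≡ b + d [mod m ]
    ≡-mod-+ {a} {b} {c} {d} (mod-via m∣a-b) (mod-via m∣c-d) =
      mod-via (subst (m ∣_) (lemma a b c d) (∣m∣n⇒∣m+n m∣a-b m∣c-d))
      where
      lemma : ∀ a b c d → a - b + (c - d) ≡ a + c - (b + d)
      lemma = solve-∀

    ≡-mod-* : ∀ {a b c d} → a ≡ b [mod m ] → c ≡ d [mod m ] → a * c ≡ b * d [mod m ]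
    ≡-mod-* {a} {b} {c} {d} (mod-via m∣a-b) (mod-via m∣c-d) =
      mod-via (subst (m ∣_) (lemma a b c d) (∣m∣n⇒∣m+n (∣n⇒∣m*n c m∣a-b) (∣n⇒∣m*n b m∣c-d)))
      where
      lemma : ∀ a b c d → c * (a - b) + b * (c - d) ≡ a * c - b * d
      lemma = solve-∀

    ∣⇒≡0-mod : ∀ {a} → m ∣ a → a ≡ 0ℤ [mod m ]
    ∣⇒≡0-mod {a} m∣a = mod-via (subst (m ∣_) (sym (+-identityʳ a)) m∣a)

    ≡0-mod⇒∣ : ∀ {a} → a ≡ 0ℤ [mod m ] → m ∣ a
    ≡0-mod⇒∣ {a} (mod-via m∣a-0) = subst (m ∣_) (+-identityʳ a) m∣a-0

    ∑-≡-mod : ∀ {n} {f g : Fin n → ℤ} → (∀ i → f i ≡ g i [mod m ]) →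
              ∑[ i < n ] f i ≡ ∑[ i < n ] g i [mod m ]
    ∑-≡-mod {ℕ.zero} _ = ≡-mod-reflexive refl
    ∑-≡-mod {ℕ.suc n} f≡g = ≡-mod-+ (f≡g zero) (∑-≡-mod (f≡g ∘ suc))

  ≡-mod-setoid : ℤ → Setoid 0ℓ 0ℓ
  ≡-mod-setoid m = record
    { Carrier = ℤ
    ; _≈_ = _≡_[mod m ]
    ; isEquivalence = record
      { refl = ≡-mod-reflexive refl ; sym = ≡-mod-sym ; trans = ≡-mod-trans }
    }

  %ℕ-≡-mod : ∀ z q .{{_ : ℕ.NonZero q}} → + (z %ℕ q) ≡ z [mod + q ]
  %ℕ-≡-mod z q = mod-via (divides (- (z /ℕ q))
    (trans (cong (_-_ (+ (z %ℕ q))) (a≡a%ℕn+[a/ℕn]*n z q)) (lemma (+ (z %ℕ q)) (z /ℕ q) (+ q))))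
    where
    lemma : ∀ r t d → r - (r + t * d) ≡ - t * d
    lemma = solve-∀

module ShiftCombinations where
  open import Data.Nat as ℕ using (ℕ; zero; suc)
  import Data.Nat.Properties as ℕ
  open import Data.Fin as Fin using (Fin; toℕ)
  open import Data.Integer hiding (suc)
  open import Data.Integer.Properties
  open import Data.Integer.Tactic.RingSolver using (solve-∀)
  open import Data.List using (List; []; _∷_; length)
  open import Data.List.Membership.Propositional using (_∈_; _∉_)
  open import Data.List.Relation.Unary.Any using (here; there)
  open import Data.Sum using (inj₁; inj₂)
  open import Function using (_∘_)
  open import Relation.Binary.PropositionalEquality
  open FiniteSums using (sum-syntax; module ℤΣ)

  -- p ⟨ f ⟩ n is the value at n of the sequence p(S) f, where S is the shift (S f) m = f (m + 1).
  _⟨_⟩_ : List ℤ → (ℕ → ℤ) → ℕ → ℤ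
  [] ⟨ f ⟩ n = 0ℤ
  (a ∷ p) ⟨ f ⟩ n = a * f n + p ⟨ f ⟩ suc n

  ⟨⟩-cong : ∀ p {f g} n → (∀ m → f m ≡ g m) → p ⟨ f ⟩ n ≡ p ⟨ g ⟩ n
  ⟨⟩-cong [] n f≗g = refl
  ⟨⟩-cong (a ∷ p) n f≗g = cong₂ _+_ (cong (a *_) (f≗g n)) (⟨⟩-cong p (suc n) f≗g)

  ⟨⟩-zero : ∀ p n → p ⟨ (λ _ → 0ℤ) ⟩ n ≡ 0ℤ
  ⟨⟩-zero [] n = refl
  ⟨⟩-zero (a ∷ p) n = trans (cong₂ _+_ (*-zeroʳ a) (⟨⟩-zero p (suc n))) (+-identityˡ 0ℤ)

  ⟨⟩-+ : ∀ p f g n → p ⟨ (λ m → f m + g m) ⟩ n ≡ p ⟨ f ⟩ n + p ⟨ g ⟩ n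
  ⟨⟩-+ [] f g n = refl
  ⟨⟩-+ (a ∷ p) f g n = trans (cong (_+_ (a * (f n + g n))) (⟨⟩-+ p f g (suc n)))
                              (lemma a (f n) (g n) (p ⟨ f ⟩ suc n) (p ⟨ g ⟩ suc n))
    where
    lemma : ∀ a x y u v → a * (x + y) + (u + v) ≡ a * x + u + (a * y + v)
    lemma = solve-∀

  ⟨⟩-* : ∀ p x f n → p ⟨ (λ m → x * f m) ⟩ n ≡ x * p ⟨ f ⟩ n
  ⟨⟩-* [] x f n = sym (*-zeroʳ x)
  ⟨⟩-* (a ∷ p) x f n = trans (cong (_+_ (a * (x * f n))) (⟨⟩-* p x f (suc n)))
                              (lemma a x (f n) (p ⟨ f ⟩ suc n))
    where
    lemma : ∀ a x y u → a * (x * y) + x * u ≡ x * (a * y + u)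
    lemma = solve-∀

  ⟨⟩-∑ : ∀ p k (F : Fin k → ℕ → ℤ) n → p ⟨ (λ m → ∑[ e < k ] F e m) ⟩ n ≡ ∑[ e < k ] p ⟨ F e ⟩ n
  ⟨⟩-∑ p zero F n = ⟨⟩-zero p n
  ⟨⟩-∑ p (suc k) F n = trans (⟨⟩-+ p (F Fin.zero) _ n)
                             (cong (_+_ (p ⟨ F Fin.zero ⟩ n)) (⟨⟩-∑ p k (F ∘ Fin.suc) n))

  coefficient : List ℤ → ℕ → ℤ
  coefficient [] i = 0ℤ
  coefficient (a ∷ p) zero = a
  coefficient (a ∷ p) (suc i) = coefficient p i

  ⟨⟩-as-∑ : ∀ p K f n → length p ℕ.≤ K → p ⟨ f ⟩ n ≡ ∑[ i < K ] (coefficient p (toℕ i) * f (n ℕ.+ toℕ i))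
  ⟨⟩-as-∑ [] K f n _ = sym (trans (ℤΣ.sum-cong-≗ {K} (λ i → *-zeroˡ (f (n ℕ.+ toℕ i)))) (ℤΣ.sum-replicate-zero K))
  ⟨⟩-as-∑ (a ∷ p) (suc K) f n (ℕ.s≤s |p|≤K) = cong₂ _+_
    (cong (λ m → a * f m) (sym (ℕ.+-identityʳ n)))
    (trans (⟨⟩-as-∑ p K f (suc n) |p|≤K)
           (ℤΣ.sum-cong-≗ {K} λ i → cong (λ m → coefficient p (toℕ i) * f m) (sym (ℕ.+-suc n (toℕ i)))))

  -- The coefficients of b + (y - r) p(y).
  affine : ℤ → ℤ → List ℤ → List ℤ
  affine r b [] = b ∷ []
  affine r b (a ∷ p) = (b - r * a) ∷ affine r a p

  ⟨⟩-affine : ∀ r b p f n → affine r b p ⟨ f ⟩ n ≡ b * f n + p ⟨ (λ m → f (suc m) - r * f m) ⟩ n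
  ⟨⟩-affine r b [] f n = refl
  ⟨⟩-affine r b (a ∷ p) f n =
    trans (cong (_+_ ((b - r * a) * f n)) (⟨⟩-affine r a p f (suc n)))
          (lemma b r a (f n) (f (suc n)) (p ⟨ (λ m → f (suc m) - r * f m) ⟩ suc n))
    where
    lemma : ∀ b r a x y u → (b - r * a) * x + (a * y + u) ≡ b * x + (a * (y - r * x) + u)
    lemma = solve-∀

  linearProduct : List ℤ → List ℤ
  linearProduct [] = 1ℤ ∷ []
  linearProduct (r ∷ R) = affine r 0ℤ (linearProduct R)

  evalProduct : List ℤ → ℤ → ℤ
  evalProduct [] y = 1ℤ
  evalProduct (r ∷ R) y = (y - r) * evalProduct R y

  length-affine : ∀ r b p → length (affine r b p) ≡ suc (length p)
  length-affine r b [] = refl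
  length-affine r b (a ∷ p) = cong suc (length-affine r a p)

  length-linearProduct : ∀ R → length (linearProduct R) ≡ suc (length R)
  length-linearProduct [] = refl
  length-linearProduct (r ∷ R) = trans (length-affine r 0ℤ (linearProduct R)) (cong suc (length-linearProduct R))

  ⟨⟩-linearProduct-geometric : ∀ R x f → (∀ m → f (suc m) ≡ x * f m) → ∀ n →
                               linearProduct R ⟨ f ⟩ n ≡ evalProduct R x * f n
  ⟨⟩-linearProduct-geometric [] x f _ n = +-identityʳ (1ℤ * f n)
  ⟨⟩-linearProduct-geometric (r ∷ R) x f ratio n = begin
    affine r 0ℤ P ⟨ f ⟩ n                            ≡⟨ ⟨⟩-affine r 0ℤ P f n ⟩
    0ℤ * f n + P ⟨ (λ m → f (suc m) - r * f m) ⟩ n    ≡⟨ cong (_+_ (0ℤ * f n)) (⟨⟩-cong P n step) ⟩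
    0ℤ * f n + P ⟨ (λ m → (x - r) * f m) ⟩ n          ≡⟨ cong (_+_ (0ℤ * f n)) (⟨⟩-* P (x - r) f n) ⟩
    0ℤ * f n + (x - r) * P ⟨ f ⟩ n
      ≡⟨ cong (λ v → 0ℤ * f n + (x - r) * v) (⟨⟩-linearProduct-geometric R x f ratio n) ⟩
    0ℤ * f n + (x - r) * (evalProduct R x * f n)     ≡⟨ lemma (f n) (x - r) (evalProduct R x) ⟩
    (x - r) * evalProduct R x * f n                  ∎
    where
    open ≡-Reasoning
    P = linearProduct R
    step : ∀ m → f (suc m) - r * f m ≡ (x - r) * f m
    step m = trans (cong (λ v → v - r * f m) (ratio m)) (factor x r (f m))
      where
      factor : ∀ x r y → x * y - r * y ≡ (x - r) * y
      factor = solve-∀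
    lemma : ∀ y d e → 0ℤ * y + d * (e * y) ≡ d * e * y
    lemma = solve-∀

  evalProduct-∈ : ∀ {x R} → x ∈ R → evalProduct R x ≡ 0ℤ
  evalProduct-∈ {x} {r ∷ R} (here refl) = trans (cong (_* evalProduct R x) (+-inverseʳ x)) (*-zeroˡ (evalProduct R x))
  evalProduct-∈ {x} {r ∷ R} (there x∈R) = trans (cong ((x - r) *_) (evalProduct-∈ x∈R)) (*-zeroʳ (x - r))

  evalProduct-∉ : ∀ {x} R → x ∉ R → evalProduct R x ≢ 0ℤ
  evalProduct-∉ {x} (r ∷ R) x∉R eq with i*j≡0⇒i≡0∨j≡0 (x - r) eq
  ... | inj₁ x-r≡0 = x∉R (here (i-j≡0⇒i≡j x r x-r≡0))
  ... | inj₂ rest≡0 = evalProduct-∉ R (x∉R ∘ there) rest≡0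

module Repunits where
  open import Data.Nat
  open import Data.Nat.Properties
  open import Data.Nat.Tactic.RingSolver using (solve-∀)
  open import Relation.Binary.PropositionalEquality

  c-zero : ∀ b → c b 0 ≡ b
  c-zero zero = refl
  c-zero (suc b) = cong suc (trans (+-identityʳ (c b 0)) (c-zero b))

  c-shift : ∀ k n i → c k (n + i) ≤ 2 ^ (i * k) * c k n
  c-shift zero n i = z≤n
  c-shift (suc k) n i = begin
    1 + 2 ^ (n + i) * c k (n + i)                       ≤⟨ +-monoʳ-≤ 1 (*-monoʳ-≤ (2 ^ (n + i)) (c-shift k n i)) ⟩
    1 + 2 ^ (n + i) * (2 ^ (i * k) * c k n)             ≡⟨ cong (1 +_) powers ⟩
    1 + 2 ^ (i * suc k) * (2 ^ n * c k n)               ≤⟨ +-monoˡ-≤ _ (m^n>0 2 (i * suc k)) ⟩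
    2 ^ (i * suc k) + 2 ^ (i * suc k) * (2 ^ n * c k n) ≡⟨ *-suc (2 ^ (i * suc k)) (2 ^ n * c k n) ⟨
    2 ^ (i * suc k) * c (suc k) n                       ∎
    where
    open ≤-Reasoning
    lemma : ∀ a b d x → a * b * (d * x) ≡ b * d * (a * x)
    lemma = solve-∀
    powers : 2 ^ (n + i) * (2 ^ (i * k) * c k n) ≡ 2 ^ (i * suc k) * (2 ^ n * c k n)
    powers = begin-equality
      2 ^ (n + i) * (2 ^ (i * k) * c k n)         ≡⟨ cong (_* (2 ^ (i * k) * c k n)) (^-distribˡ-+-* 2 n i) ⟩
      2 ^ n * 2 ^ i * (2 ^ (i * k) * c k n)       ≡⟨ lemma (2 ^ n) (2 ^ i) (2 ^ (i * k)) (c k n) ⟩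
      2 ^ i * 2 ^ (i * k) * (2 ^ n * c k n)       ≡⟨ cong (_* (2 ^ n * c k n)) (^-distribˡ-+-* 2 i (i * k)) ⟨
      2 ^ (i + i * k) * (2 ^ n * c k n)           ≡⟨ cong (λ e → 2 ^ e * (2 ^ n * c k n)) (*-suc i k) ⟨
      2 ^ (i * suc k) * (2 ^ n * c k n)           ∎

  c-upper : ∀ k n → c (suc k) n ≤ suc k * 2 ^ (n * k)
  c-upper zero n rewrite *-zeroʳ n | *-zeroʳ (2 ^ n) = ≤-refl
  c-upper (suc k) n = begin
    1 + 2 ^ n * c (suc k) n                       ≤⟨ +-monoʳ-≤ 1 (*-monoʳ-≤ (2 ^ n) (c-upper k n)) ⟩
    1 + 2 ^ n * (suc k * 2 ^ (n * k))             ≡⟨ cong (1 +_) powers ⟩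
    1 + suc k * 2 ^ (n * suc k)                   ≤⟨ +-monoˡ-≤ _ (m^n>0 2 (n * suc k)) ⟩
    2 ^ (n * suc k) + suc k * 2 ^ (n * suc k)     ∎
    where
    open ≤-Reasoning
    lemma : ∀ a b d → a * (b * d) ≡ b * (a * d)
    lemma = solve-∀
    powers : 2 ^ n * (suc k * 2 ^ (n * k)) ≡ suc k * 2 ^ (n * suc k)
    powers = trans (lemma (2 ^ n) (suc k) (2 ^ (n * k)))
                   (cong (suc k *_) (trans (sym (^-distribˡ-+-* 2 n (n * k))) (cong (2 ^_) (sym (*-suc n k)))))

module RepunitCongruences where
  open import Data.Nat as ℕ using (ℕ; zero; suc)
  import Data.Nat.Properties as ℕ
  open import Data.Fin using (toℕ)
  open import Data.Integer hiding (suc)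
  open import Data.Integer.Properties
  open import Data.Integer.Tactic.RingSolver using (solve-∀)
  open import Relation.Binary.PropositionalEquality
  open FiniteSums using (sum-syntax; module ℤΣ)
  open Congruences
  open Repunits using (c-zero)

  +c-suc : ∀ b m → + c (suc b) m ≡ 1ℤ + + (2 ℕ.^ m) * + c b m
  +c-suc b m = trans (pos-+ 1 _) (cong (_+_ 1ℤ) (pos-* (2 ℕ.^ m) (c b m)))

  +2^-* : ∀ m e → + (2 ℕ.^ m) * + (2 ℕ.^ (m ℕ.* e)) ≡ + (2 ℕ.^ (m ℕ.* suc e))
  +2^-* m e = trans (sym (pos-* (2 ℕ.^ m) _))
                    (cong +_ (trans (sym (ℕ.^-distribˡ-+-* 2 m (m ℕ.* e))) (cong (2 ℕ.^_) (sym (ℕ.*-suc m e)))))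

  c-as-∑ : ∀ k m → + c k m ≡ ∑[ e < k ] (+ (2 ℕ.^ (m ℕ.* toℕ e)))
  c-as-∑ zero m = refl
  c-as-∑ (suc k) m = begin
    + c (suc k) m                                         ≡⟨ +c-suc k m ⟩
    1ℤ + + (2 ℕ.^ m) * + c k m                            ≡⟨ cong (λ v → 1ℤ + + (2 ℕ.^ m) * v) (c-as-∑ k m) ⟩
    1ℤ + + (2 ℕ.^ m) * ∑[ e < k ] (+ (2 ℕ.^ (m ℕ.* toℕ e)))
      ≡⟨ cong₂ _+_ first (ℤΣ.*-distribˡ-sum {k} (+ (2 ℕ.^ m)) (λ e → + (2 ℕ.^ (m ℕ.* toℕ e)))) ⟩
    + (2 ℕ.^ (m ℕ.* 0)) + ∑[ e < k ] (+ (2 ℕ.^ m) * + (2 ℕ.^ (m ℕ.* toℕ e)))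
      ≡⟨ cong (_+_ (+ (2 ℕ.^ (m ℕ.* 0)))) (ℤΣ.sum-cong-≗ {k} λ e → +2^-* m (toℕ e)) ⟩
    ∑[ e < suc k ] (+ (2 ℕ.^ (m ℕ.* toℕ e)))               ∎
    where
    open ≡-Reasoning
    first : 1ℤ ≡ + (2 ℕ.^ (m ℕ.* 0))
    first = cong (λ e → + (2 ℕ.^ e)) (sym (ℕ.*-zeroʳ m))

  c-telescope : ∀ b m → (+ (2 ℕ.^ m) - 1ℤ) * + c b m ≡ + (2 ℕ.^ (m ℕ.* b)) - 1ℤ
  c-telescope zero m = trans (*-zeroʳ (+ (2 ℕ.^ m) - 1ℤ)) (cong (λ e → + (2 ℕ.^ e) - 1ℤ) (sym (ℕ.*-zeroʳ m)))
  c-telescope (suc b) m = begin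
    (y - 1ℤ) * + c (suc b) m               ≡⟨ cong ((y - 1ℤ) *_) (+c-suc b m) ⟩
    (y - 1ℤ) * (1ℤ + y * + c b m)          ≡⟨ lemma y (+ c b m) ⟩
    y - 1ℤ + y * ((y - 1ℤ) * + c b m)      ≡⟨ cong (λ v → y - 1ℤ + y * v) (c-telescope b m) ⟩
    y - 1ℤ + y * (+ (2 ℕ.^ (m ℕ.* b)) - 1ℤ) ≡⟨ lemma′ y (+ (2 ℕ.^ (m ℕ.* b))) ⟩
    y * + (2 ℕ.^ (m ℕ.* b)) - 1ℤ           ≡⟨ cong (_- 1ℤ) (+2^-* m b) ⟩
    + (2 ℕ.^ (m ℕ.* suc b)) - 1ℤ           ∎
    where
    open ≡-Reasoning
    y = + (2 ℕ.^ m)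
    lemma : ∀ y x → (y - 1ℤ) * (1ℤ + y * x) ≡ y - 1ℤ + y * ((y - 1ℤ) * x)
    lemma = solve-∀
    lemma′ : ∀ y z → y - 1ℤ + y * (z - 1ℤ) ≡ y * z - 1ℤ
    lemma′ = solve-∀

  c-cong : ∀ b {q m m′} → + (2 ℕ.^ m) ≡ + (2 ℕ.^ m′) [mod q ] → + c b m ≡ + c b m′ [mod q ]
  c-cong zero _ = ≡-mod-reflexive refl
  c-cong (suc b) {q} {m} {m′} 2^m≡2^m′ = subst₂ (λ x y → x ≡ y [mod q ]) (sym (+c-suc b m)) (sym (+c-suc b m′))
    (≡-mod-+ (≡-mod-reflexive {a = 1ℤ} refl) (≡-mod-* 2^m≡2^m′ (c-cong b {q} {m} {m′} 2^m≡2^m′)))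

  c-one : ∀ b → + c b 1 ≡ + (2 ℕ.^ b) - 1ℤ
  c-one b = trans (sym (*-identityˡ (+ c b 1)))
                  (trans (c-telescope b 1) (cong (λ e → + (2 ℕ.^ e) - 1ℤ) (ℕ.*-identityˡ b)))

  +c-zero : ∀ b → + c b 0 ≡ + b
  +c-zero b = cong +_ (c-zero b)

module Divisibility where
  open import Data.Nat as ℕ using (ℕ; zero; suc)
  import Data.Nat.Properties as ℕ
  open import Data.Nat.GCD using (gcd; gcd-GCD; module Bézout)
  open import Data.Integer hiding (suc)
  open import Data.Integer.Properties
  open import Data.Integer.Divisibility.Signed
  open import Data.Integer.Tactic.RingSolver using (solve-∀)
  open import Data.List using (List; []; _∷_; map)
  open import Data.List.Relation.Unary.All using (All; []; _∷_)
  open import Data.Product using (Σ; _×_; _,_)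
  open import Relation.Binary.PropositionalEquality
  open Congruences
  open RepunitCongruences using (c-telescope; c-cong; +c-zero)
  open ShiftCombinations using (evalProduct)

  pos-∸1 : ∀ {a} → 1 ℕ.≤ a → + (a ℕ.∸ 1) ≡ + a - 1ℤ
  pos-∸1 {a} 1≤a = trans (sym (⊖-≥ 1≤a)) (sym (m-n≡m⊖n a 1))

  ∣2^-pred⇒∣2^*-pred : ∀ {a} D s → a ∣ + (2 ℕ.^ D) - 1ℤ → a ∣ + (2 ℕ.^ (D ℕ.* s)) - 1ℤ
  ∣2^-pred⇒∣2^*-pred {a} D s a∣ = subst (a ∣_) (c-telescope s D) (∣m⇒∣m*n (+ c s D) a∣)

  -- Since 2^D ≡ 1 mod b, the quotient (2^(D B) - 1)/(2^D - 1) = c B D is ≡ B ≡ 0 mod b.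
  *-∣2^-pred : ∀ {a b} D B → a ∣ + (2 ℕ.^ D) - 1ℤ → b ∣ + (2 ℕ.^ D) - 1ℤ → b ∣ + B →
               a * b ∣ + (2 ℕ.^ (D ℕ.* B)) - 1ℤ
  *-∣2^-pred {a} {b} D B a∣ b∣ b∣B = subst (a * b ∣_) (c-telescope B D)
    (∣-trans (*-monoˡ-∣ b a∣) (*-monoʳ-∣ (+ (2 ℕ.^ D) - 1ℤ) b∣c))
    where
    b∣c : b ∣ + c B D
    b∣c = ≡0-mod⇒∣ (≡-mod-trans (c-cong B (mod-via b∣))
                                 (≡-mod-trans (≡-mod-reflexive (+c-zero B)) (∣⇒≡0-mod b∣B)))

  period : ∀ es → All (1 ℕ.≤_) es →
           Σ ℕ λ D → 1 ℕ.≤ D × evalProduct (map (λ e → + (2 ℕ.^ e)) es) 1ℤ ∣ + (2 ℕ.^ D) - 1ℤ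
  period [] [] = 1 , ℕ.≤-refl , divides (+ 1) refl
  period (e ∷ es) (1≤e ∷ 1≤es) with period es 1≤es
  ... | D , 1≤D , g∣ = D ℕ.* e ℕ.* B , 1≤D*e*B ,
                        subst (_∣ + (2 ℕ.^ (D ℕ.* e ℕ.* B)) - 1ℤ) (*-comm g f) (*-∣2^-pred (D ℕ.* e) B g∣′ f∣′ f∣B)
    where
    g = evalProduct (map (λ e → + (2 ℕ.^ e)) es) 1ℤ
    f = 1ℤ - + (2 ℕ.^ e)
    B = 2 ℕ.^ e ℕ.∸ 1
    1≤B : 1 ℕ.≤ B
    1≤B = ℕ.∸-monoˡ-≤ 1 (ℕ.^-monoʳ-≤ 2 1≤e)
    1≤D*e*B : 1 ℕ.≤ D ℕ.* e ℕ.* B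
    1≤D*e*B = ℕ.*-mono-≤ (ℕ.*-mono-≤ 1≤D 1≤e) 1≤B
    f∣B : f ∣ + B
    f∣B = divides -1ℤ (trans (pos-∸1 (ℕ.m^n>0 2 e)) (lemma (+ (2 ℕ.^ e))))
      where
      lemma : ∀ y → y - 1ℤ ≡ -1ℤ * (1ℤ - y)
      lemma = solve-∀
    f∣′ : f ∣ + (2 ℕ.^ (D ℕ.* e)) - 1ℤ
    f∣′ = subst (λ x → f ∣ + (2 ℕ.^ x) - 1ℤ) (ℕ.*-comm e D)
                (∣2^-pred⇒∣2^*-pred e D (subst (f ∣_) (pos-∸1 (ℕ.m^n>0 2 e)) f∣B))
    g∣′ : g ∣ + (2 ℕ.^ (D ℕ.* e)) - 1ℤ
    g∣′ = ∣2^-pred⇒∣2^*-pred D e g∣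

  bézout : ∀ m n → Σ ℤ λ α → Σ ℤ λ β → + gcd m n ≡ α * + m + β * + n
  bézout m n with Bézout.identity (gcd-GCD m n)
  ... | Bézout.+- x y eq = + x , - + y , lemma (+ gcd m n) (+ x) (+ y) (+ m) (+ n) (cast eq)
    where
    cast : gcd m n ℕ.+ y ℕ.* n ≡ x ℕ.* m → + gcd m n + + y * + n ≡ + x * + m
    cast eq = trans (sym (trans (pos-+ (gcd m n) _) (cong (_+_ (+ gcd m n)) (pos-* y n))))
                    (trans (cong +_ eq) (pos-* x m))
    lemma : ∀ d x y m n → d + y * n ≡ x * m → d ≡ x * m + - y * n
    lemma d x y m n eq = trans (identity d y n) (cong (λ v → v + - y * n) eq)
      where
      identity : ∀ d y n → d ≡ d + y * n + - y * n
      identity = solve-∀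
  ... | Bézout.-+ x y eq = - + x , + y , lemma (+ gcd m n) (+ x) (+ y) (+ m) (+ n) (cast eq)
    where
    cast : gcd m n ℕ.+ x ℕ.* m ≡ y ℕ.* n → + gcd m n + + x * + m ≡ + y * + n
    cast eq = trans (sym (trans (pos-+ (gcd m n) _) (cong (_+_ (+ gcd m n)) (pos-* x m))))
                    (trans (cong +_ eq) (pos-* y n))
    lemma : ∀ d x y m n → d + x * m ≡ y * n → d ≡ - x * m + y * n
    lemma d x y m n eq = trans (identity d x m) (cong (_+_ (- x * m)) eq)
      where
      identity : ∀ d x m → d ≡ - x * m + (d + x * m)
      identity = solve-∀

module MixedRadix where
  open import Data.Nat
  open import Data.Nat.Properties
  open import Data.Nat.DivMod using (_/_; _%_; m≡m%n+[m/n]*n; m/n*n≡m; m/n*n≤m; m%n<n)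
  open import Data.Nat.Divisibility using (_∣_; %-presˡ-∣)
  open import Data.Fin using (Fin; toℕ; fromℕ; inject₁)
  open import Data.Fin.Properties using (toℕ-inject₁; toℕ-fromℕ; toℕ<n)
  open import Data.Sum using (inj₁; inj₂)
  open import Relation.Binary.PropositionalEquality
  open import Relation.Nullary using (yes; no; contradiction)
  open FiniteSums using (∑ℕ-syntax; module ℕΣ)

  record Expansion (M : ℕ → ℕ) (j D : ℕ) : Set where
    field
      digit : ℕ → ℕ
      sum-digits : D ≡ ∑ℕ[ e < suc j ] (digit (toℕ e) * M (toℕ e))
      top-digit≤ : digit j * M j ≤ D
      digit< : ∀ e → e < j → digit e * M e < M (suc e)

  expansion : ∀ j (M : ℕ → ℕ) {{_ : ∀ {e} → NonZero (M e)}} → (∀ e → M 0 ∣ M e) → ∀ {D} → M 0 ∣ D →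
              Expansion M j D
  expansion zero M _ {D} M₀∣D = record
    { digit = λ _ → D / M 0
    ; sum-digits = sym (trans (+-identityʳ _) (m/n*n≡m M₀∣D))
    ; top-digit≤ = m/n*n≤m D (M 0)
    ; digit< = λ _ ()
    }
  expansion (suc j) M M₀∣M {D} M₀∣D = record
    { digit = digit
    ; sum-digits = sum-digits
    ; top-digit≤ = subst (λ t → t * M (suc j) ≤ D) (sym digit-top) (m/n*n≤m D (M (suc j)))
    ; digit< = digit<
    }
    where
    R = D % M (suc j)
    lower : Expansion M j R
    lower = expansion j M M₀∣M (%-presˡ-∣ M₀∣D (M₀∣M (suc j)))
    open Expansion lower using () renaming (digit to low)
    digit : ℕ → ℕ
    digit e with e ≟ suc j
    ... | yes _ = D / M (suc j)
    ... | no _ = low e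
    digit-top : digit (suc j) ≡ D / M (suc j)
    digit-top with suc j ≟ suc j
    ... | yes _ = refl
    ... | no j+1≢j+1 = contradiction refl j+1≢j+1
    digit-low : ∀ e → e ≤ j → digit e ≡ low e
    digit-low e e≤j with e ≟ suc j
    ... | yes refl = contradiction e≤j (n≮n j)
    ... | no _ = refl
    term : ℕ → ℕ
    term e = digit e * M e
    sum-digits : D ≡ ∑ℕ[ e < suc (suc j) ] term (toℕ e)
    sum-digits = begin
      D                                                  ≡⟨ m≡m%n+[m/n]*n D (M (suc j)) ⟩
      R + D / M (suc j) * M (suc j)                      ≡⟨ cong₂ _+_ (Expansion.sum-digits lower) (cong (_* M (suc j)) (sym digit-top)) ⟩
      ∑ℕ[ e < suc j ] (low (toℕ e) * M (toℕ e)) + term (suc j)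
        ≡⟨ cong (_+ term (suc j)) (ℕΣ.sum-cong-≗ {suc j} λ e →
             cong (_* M (toℕ e)) (sym (digit-low (toℕ e) (≤-pred (toℕ<n e))))) ⟩
      ∑ℕ[ e < suc j ] term (toℕ e) + term (suc j)
        ≡⟨ cong₂ _+_ (ℕΣ.sum-cong-≗ {suc j} λ e → cong term (sym (toℕ-inject₁ e)))
                     (cong term (sym (toℕ-fromℕ (suc j)))) ⟩
      ∑ℕ[ e < suc j ] term (toℕ (inject₁ e)) + term (toℕ (fromℕ (suc j)))
        ≡⟨ ℕΣ.sum-init-last {suc j} (λ e → term (toℕ e)) ⟨
      ∑ℕ[ e < suc (suc j) ] term (toℕ e)                 ∎
      where open ≡-Reasoning
    digit< : ∀ e → e < suc j → digit e * M e < M (suc e)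
    digit< e (s≤s e≤j) with m≤n⇒m<n∨m≡n e≤j
    ... | inj₁ e<j = subst (λ t → t * M e < M (suc e)) (sym (digit-low e e≤j)) (Expansion.digit< lower e e<j)
    ... | inj₂ refl = subst (λ t → t * M e < M (suc e)) (sym (digit-low e e≤j))
                            (≤-<-trans (Expansion.top-digit≤ lower) (m%n<n D (M (suc e))))

module Combinations (k : Data.Nat.ℕ) where
  open import Data.Nat as ℕ using (ℕ; zero; suc)
  import Data.Nat.Properties as ℕ
  open import Data.Nat.Logarithm using (⌊log₂_⌋; ⌊log₂[2^n]⌋≡n)
  open import Data.Fin using (toℕ)
  open import Data.Integer hiding (suc)
  open import Data.Integer.Properties
  open import Data.Integer.Divisibility.Signed using (_∣_)
  open import Data.List using (List; map; filter; upTo; length)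
  open import Data.List.Properties using (length-map; length-filter; length-upTo)
  open import Data.List.Membership.Propositional using (_∉_)
  open import Data.List.Membership.Propositional.Properties using (∈-map⁺; ∈-map⁻; ∈-filter⁺; ∈-filter⁻; ∈-upTo⁺)
  open import Data.List.Relation.Unary.All as All using (All)
  open import Data.List.Relation.Unary.All.Properties using (all-filter)
  open import Data.Product using (Σ; _×_; _,_)
  open import Relation.Binary.PropositionalEquality
  open import Relation.Nullary using (¬?)
  open FiniteSums using (sum-syntax; ∑-pick)
  open ShiftCombinations
  open RepunitCongruences using (c-as-∑)
  open Divisibility using (period)

  pow2 : ℕ → ℤ
  pow2 e = + (2 ℕ.^ e)

  exponentsExcept : ℕ → List ℕ
  exponentsExcept e = filter (λ e′ → ¬? (e′ ℕ.≟ e)) (upTo k)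

  roots : ℕ → List ℤ
  roots e = map pow2 (exponentsExcept e)

  -- P e annihilates the sequences m ↦ 2^(e′ m) for e′ ≠ e, so P e ⟨ c k ⟩ isolates the term with 2^(e m).
  P : ℕ → List ℤ
  P e = linearProduct (roots e)

  G : ℕ → ℤ
  G e = evalProduct (roots e) (pow2 e)

  length-P : ∀ e → length (P e) ℕ.≤ suc k
  length-P e = begin
    length (P e)                      ≡⟨ length-linearProduct (roots e) ⟩
    suc (length (roots e))            ≡⟨ cong suc (length-map pow2 (exponentsExcept e)) ⟩
    suc (length (exponentsExcept e))  ≤⟨ ℕ.s≤s (length-filter (λ e′ → ¬? (e′ ℕ.≟ e)) (upTo k)) ⟩
    suc (length (upTo k))             ≡⟨ cong suc (length-upTo k) ⟩
    suc k                             ∎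
    where open ℕ.≤-Reasoning

  pow2-injective : ∀ {e e′} → pow2 e ≡ pow2 e′ → e ≡ e′
  pow2-injective {e} {e′} eq =
    trans (sym (⌊log₂[2^n]⌋≡n e)) (trans (cong (λ x → ⌊log₂ ∣ x ∣ ⌋) eq) (⌊log₂[2^n]⌋≡n e′))

  G≢0 : ∀ e → G e ≢ 0ℤ
  G≢0 e = evalProduct-∉ (roots e) pow2e∉
    where
    pow2e∉ : pow2 e ∉ roots e
    pow2e∉ p with ∈-map⁻ pow2 p
    ... | e′ , e′∈ , eq with ∈-filter⁻ (λ e′ → ¬? (e′ ℕ.≟ e)) {xs = upTo k} e′∈
    ...   | _ , e′≢e = e′≢e (sym (pow2-injective eq))

  P-vanishes-at : ∀ e {e′} → e′ ℕ.< k → e′ ≢ e → evalProduct (roots e) (pow2 e′) ≡ 0ℤ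
  P-vanishes-at e e′<k e′≢e =
    evalProduct-∈ (∈-map⁺ pow2 (∈-filter⁺ (λ e′ → ¬? (e′ ℕ.≟ e)) (∈-upTo⁺ e′<k) e′≢e))

  P⟨c⟩ : ∀ e n → e ℕ.< k → P e ⟨ (λ m → + c k m) ⟩ n ≡ G e * + (2 ℕ.^ (n ℕ.* e))
  P⟨c⟩ e n e<k = begin
    P e ⟨ (λ m → + c k m) ⟩ n                                 ≡⟨ ⟨⟩-cong (P e) n (c-as-∑ k) ⟩
    P e ⟨ (λ m → ∑[ e′ < k ] (+ (2 ℕ.^ (m ℕ.* toℕ e′)))) ⟩ n  ≡⟨ ⟨⟩-∑ (P e) k _ n ⟩
    ∑[ e′ < k ] P e ⟨ (λ m → + (2 ℕ.^ (m ℕ.* toℕ e′))) ⟩ n     ≡⟨ FiniteSums.ℤΣ.sum-cong-≗ {k} geometric ⟩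
    ∑[ e′ < k ] term (toℕ e′)                                 ≡⟨ ∑-pick k term e<k vanishing ⟩
    G e * + (2 ℕ.^ (n ℕ.* e))                                 ∎
    where
    open ≡-Reasoning
    term : ℕ → ℤ
    term e′ = evalProduct (roots e) (pow2 e′) * + (2 ℕ.^ (n ℕ.* e′))
    ratio : ∀ e′ m → + (2 ℕ.^ (suc m ℕ.* e′)) ≡ pow2 e′ * + (2 ℕ.^ (m ℕ.* e′))
    ratio e′ m = trans (cong +_ (ℕ.^-distribˡ-+-* 2 e′ (m ℕ.* e′))) (pos-* (2 ℕ.^ e′) _)
    geometric : ∀ e′ → P e ⟨ (λ m → + (2 ℕ.^ (m ℕ.* toℕ e′))) ⟩ n ≡ term (toℕ e′)
    geometric e′ = ⟨⟩-linearProduct-geometric (roots e) _ _ (ratio (toℕ e′)) n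
    vanishing : ∀ e′ → e′ ℕ.< k → e′ ≢ e → term e′ ≡ 0ℤ
    vanishing e′ e′<k e′≢e = trans (cong (_* + (2 ℕ.^ (n ℕ.* e′))) (P-vanishes-at e e′<k e′≢e))
                                   (*-zeroˡ (+ (2 ℕ.^ (n ℕ.* e′))))

  G0-period : Σ ℕ λ D → 1 ℕ.≤ D × G 0 ∣ + (2 ℕ.^ D) - 1ℤ
  G0-period = period (exponentsExcept 0) (All.map ℕ.n≢0⇒n>0 (all-filter (λ e′ → ¬? (e′ ℕ.≟ 0)) (upTo k)))

module Bounds where
  open import Data.Nat
  open import Data.Nat.Properties
  open import Data.Integer as ℤ using (ℤ; +_; -[1+_]; ∣_∣)
  open import Data.Integer.Properties using (⊖-≥)
  open import Data.Product using (Σ; _×_; _,_)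
  open import Relation.Binary.PropositionalEquality
  open import Relation.Nullary using (yes; no; contradiction)

  covering : ∀ (lo hi : ℕ → ℕ) → (∀ s → lo (suc s) ≤ hi s) → (∀ s → s < lo s) →
             ∀ {N} → lo 1 ≤ N → Σ ℕ λ s → 1 ≤ s × lo s ≤ N × N ≤ hi s
  covering lo hi overlaps grow {N} lo₁≤N = search N 1 (s≤s z≤n) lo₁≤N (<-trans (n<1+n N) (grow (suc N)))
    where
    search : ∀ fuel s → 1 ≤ s → lo s ≤ N → N < lo (s + fuel) → Σ ℕ λ s → 1 ≤ s × lo s ≤ N × N ≤ hi s
    search zero s 1≤s los≤N N<lo = contradiction los≤N (<⇒≱ (subst (λ t → N < lo t) (+-identityʳ s) N<lo))
    search (suc fuel) s 1≤s los≤N N<lo with N <? lo (suc s)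
    ... | yes N<lo′ = s , 1≤s , los≤N , ≤-trans (<⇒≤ N<lo′) (overlaps s)
    ... | no N≮lo′ = search fuel (suc s) (s≤s z≤n) (≮⇒≥ N≮lo′) (subst (λ t → N < lo t) (+-suc s fuel) N<lo)

  perturbation-bounds : ∀ b δ {L U} → ∣ δ ∣ + L ≤ b → b + ∣ δ ∣ ≤ U →
               + ∣ + b ℤ.+ δ ∣ ≡ + b ℤ.+ δ × L ≤ ∣ + b ℤ.+ δ ∣ × ∣ + b ℤ.+ δ ∣ ≤ U
  perturbation-bounds b (+ d) {L} lo hi = refl , ≤-trans (m≤n+m L d) (≤-trans lo (m≤m+n b d)) , hi
  perturbation-bounds b -[1+ d ] {L} lo hi rewrite ⊖-≥ (≤-trans (m≤m+n (suc d) L) lo) =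
    refl , ≤-trans (≤-reflexive (sym (m+n∸m≡n (suc d) L))) (∸-monoˡ-≤ (suc d) lo) ,
    ≤-trans (m∸n≤m b (suc d)) (≤-trans (m≤m+n b (suc d)) hi)

module Construction (k′ : Data.Nat.ℕ) where
  open import Data.Nat
  open import Data.Nat.Properties
  open import Data.Nat.Tactic.RingSolver using (solve-∀)
  import Data.Nat.Divisibility as ℕ∣
  open import Data.Fin using (Fin; zero; suc; toℕ; fromℕ<)
  open import Data.Fin.Properties using (toℕ-fromℕ<; toℕ<n)
  open import Data.Integer as ℤ using (ℤ; +_; ∣_∣; 0ℤ; 1ℤ)
    renaming (_+_ to _+ᶻ_; _*_ to _*ᶻ_; _-_ to _-ᶻ_)
  import Data.Integer.Properties as ℤ
  import Data.Integer.Divisibility.Signed as ℤ∣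
  open import Data.Integer.Tactic.RingSolver as ℤSolver using ()
  import Data.Integer.DivMod
  open import Data.Nat.DivMod using (_/_; _%_; m≡m%n+[m/n]*n; m%n<n; m/n*n≤m)
  open import Data.Product using (Σ; _×_; _,_; proj₁; proj₂)
  open import Data.Sum using (inj₁; inj₂)
  open import Function using (_∘_)
  open import Relation.Binary.PropositionalEquality hiding (J)
  open FiniteSums
  open ShiftCombinations using (_⟨_⟩_; coefficient; ⟨⟩-as-∑)
  open MixedRadix using (Expansion; expansion)

  k K : ℕ
  k = suc k′
  K = suc k

  open Combinations k

  Q : ℕ
  Q = ∣ G 0 ∣

  ∣G∣>0 : ∀ e → 0 < ∣ G e ∣
  ∣G∣>0 e = n≢0⇒n>0 (G≢0 e ∘ ℤ.∣i∣≡0⇒i≡0)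

  instance
    Q-nonZero : NonZero Q
    Q-nonZero = >-nonZero (∣G∣>0 0)

  sign-unit : ∀ i → Σ ℤ λ s → s *ᶻ i ≡ + ∣ i ∣
  sign-unit i with ℤ.+∣i∣≡i⊎+∣i∣≡-i i
  ... | inj₁ eq = 1ℤ , trans (ℤ.*-identityˡ i) (sym eq)
  ... | inj₂ eq = ℤ.-1ℤ , trans (ℤ.-1*i≡-i i) (sym eq)

  -- The factor Q for e ≥ 1 makes every M n e a multiple of M n 0 = Q, as the mixed radix requires.
  h : ℕ → ℕ
  h zero = 1
  h (suc e) = ∣ G (suc e) ∣

  κ : ℕ → ℤ
  κ zero = proj₁ (sign-unit (G 0))
  κ (suc e) = + Q *ᶻ proj₁ (sign-unit (G (suc e)))

  κG : ∀ e → κ e *ᶻ G e ≡ + (Q * h e)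
  κG zero = trans (proj₂ (sign-unit (G 0))) (cong +_ (sym (*-identityʳ Q)))
  κG (suc e) = begin
    + Q *ᶻ s *ᶻ G (suc e)    ≡⟨ ℤ.*-assoc (+ Q) s (G (suc e)) ⟩
    + Q *ᶻ (s *ᶻ G (suc e))  ≡⟨ cong (+ Q *ᶻ_) (proj₂ (sign-unit (G (suc e)))) ⟩
    + Q *ᶻ + h (suc e)       ≡⟨ ℤ.pos-* Q (h (suc e)) ⟨
    + (Q * h (suc e))        ∎
    where
    open ≡-Reasoning
    s = proj₁ (sign-unit (G (suc e)))

  h>0 : ∀ e → 0 < h e
  h>0 zero = s≤s z≤n
  h>0 (suc e) = ∣G∣>0 (suc e)

  μ : ℕ → Fin K → ℤ
  μ e i = κ e *ᶻ coefficient (P e) (toℕ i)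

  M : ℕ → ℕ → ℕ
  M n e = Q * h e * 2 ^ (n * e)

  μ-value : ∀ n e → e < k → ∑[ i < K ] (μ e i *ᶻ + c k (n + toℕ i)) ≡ + M n e
  μ-value n e e<k = begin
    ∑[ i < K ] (κ e *ᶻ coefficient (P e) (toℕ i) *ᶻ C (n + toℕ i))
      ≡⟨ ℤΣ.sum-cong-≗ {K} (λ i → ℤ.*-assoc (κ e) (coefficient (P e) (toℕ i)) (C (n + toℕ i))) ⟩
    ∑[ i < K ] (κ e *ᶻ (coefficient (P e) (toℕ i) *ᶻ C (n + toℕ i)))
      ≡⟨ ℤΣ.*-distribˡ-sum {K} (κ e) (λ i → coefficient (P e) (toℕ i) *ᶻ C (n + toℕ i)) ⟨
    κ e *ᶻ ∑[ i < K ] (coefficient (P e) (toℕ i) *ᶻ C (n + toℕ i))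
      ≡⟨ cong (κ e *ᶻ_) (⟨⟩-as-∑ (P e) K C n (length-P e)) ⟨
    κ e *ᶻ P e ⟨ C ⟩ n
      ≡⟨ cong (κ e *ᶻ_) (P⟨c⟩ e n e<k) ⟩
    κ e *ᶻ (G e *ᶻ + 2 ^ (n * e))
      ≡⟨ ℤ.*-assoc (κ e) (G e) _ ⟨
    κ e *ᶻ G e *ᶻ + 2 ^ (n * e)
      ≡⟨ cong (_*ᶻ + 2 ^ (n * e)) (κG e) ⟩
    + (Q * h e) *ᶻ + 2 ^ (n * e)
      ≡⟨ ℤ.pos-* (Q * h e) _ ⟨
    + M n e  ∎
    where
    open ≡-Reasoning
    C : ℕ → ℤ
    C m = + c k m

  Q-period : Σ ℕ λ d → 1 ≤ d × + Q ℤ∣.∣ + 2 ^ d -ᶻ 1ℤ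
  Q-period with G0-period
  ... | d , 1≤d , G₀∣ = d , 1≤d , ℤ∣.∣-trans ℤ∣.∣m∣∣m G₀∣

  H Cμ A : ℕ
  H = k + ∑ℕ[ e < k ] h (toℕ e)
  Cμ = ∑ℕ[ i < K ] ∑ℕ[ e < k ] ∣ μ (toℕ e) i ∣
  A = H * Cμ

  M-nonZero : ∀ {n e} → NonZero (M n e)
  M-nonZero {n} {e} = >-nonZero (*-mono-≤ (*-mono-≤ (∣G∣>0 0) (h>0 e)) (m^n>0 2 (n * e)))

  M₀ : ∀ n → M n 0 ≡ Q
  M₀ n = trans (cong (λ x → Q * 1 * 2 ^ x) (*-zeroʳ n)) (trans (*-identityʳ (Q * 1)) (*-identityʳ Q))

  M₀∣M : ∀ n e → M n 0 ℕ∣.∣ M n e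
  M₀∣M n e = subst (ℕ∣._∣ M n e) (sym (M₀ n)) (ℕ∣.∣m⇒∣m*n (2 ^ (n * e)) (ℕ∣.m∣m*n (h e)))

  h≤H : ∀ {e} → e < k → h e ≤ H
  h≤H {e} e<k = begin
    h e                         ≡⟨ cong h (toℕ-fromℕ< e<k) ⟨
    h (toℕ (fromℕ< e<k))        ≤⟨ ≤-∑ (λ e → h (toℕ e)) (fromℕ< e<k) ⟩
    ∑ℕ[ e < k ] h (toℕ e)       ≤⟨ m≤n+m _ k ⟩
    H                           ∎
    where open ≤-Reasoning

  *M-cancel : ∀ n e {t B} → t * M n e < B * (Q * 2 ^ (n * e)) → t ≤ B
  *M-cancel n e {t} {B} lt = <⇒≤ (≤-<-trans (m≤m*n t (h e) {{>-nonZero (h>0 e)}})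
                                            (*-cancelʳ-< _ _ B (subst (_< B * (Q * 2 ^ (n * e))) (lemma t (h e) Q (2 ^ (n * e))) lt)))
    where
    lemma : ∀ t g q x → t * (q * g * x) ≡ t * g * (q * x)
    lemma = solve-∀

  digit≤ : ∀ n {D} → D < Q * c k n → (X : Expansion (M n) k′ D) → ∀ e → e < k →
           Expansion.digit X e ≤ H * 2 ^ n
  digit≤ n {D} D<Qc X e (s≤s e≤k′) with m≤n⇒m<n∨m≡n e≤k′
  ... | inj₁ e<k′ = ≤-trans (*M-cancel n e (<-≤-trans (Expansion.digit< X e e<k′) (≤-reflexive next)))
                            (*-monoˡ-≤ (2 ^ n) (h≤H (s≤s e<k′)))
    where
    lemma : ∀ q g x y → q * g * (x * y) ≡ g * x * (q * y)
    lemma = solve-∀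
    next : M n (suc e) ≡ h (suc e) * 2 ^ n * (Q * 2 ^ (n * e))
    next = trans (cong (λ x → Q * h (suc e) * 2 ^ x) (*-suc n e))
                 (trans (cong (Q * h (suc e) *_) (^-distribˡ-+-* 2 n (n * e)))
                        (lemma Q (h (suc e)) (2 ^ n) (2 ^ (n * e))))
  ... | inj₂ refl = ≤-trans (*M-cancel n k′ (≤-<-trans (Expansion.top-digit≤ X) (<-≤-trans D<Qc Qc≤)))
                            (≤-trans (m≤m+n k _) (m≤m*n H (2 ^ n) {{>-nonZero (m^n>0 2 n)}}))
    where
    lemma : ∀ q x y → q * (x * y) ≡ x * (q * y)
    lemma = solve-∀
    Qc≤ : Q * c k n ≤ k * (Q * 2 ^ (n * k′))
    Qc≤ = ≤-trans (*-monoʳ-≤ Q (Repunits.c-upper k′ n)) (≤-reflexive (lemma Q k (2 ^ (n * k′))))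

  residue : ∀ n {D} → Q ℕ∣.∣ D → D < Q * c k n →
            Σ (Fin K → ℤ) λ δ → ∑[ i < K ] (δ i *ᶻ + c k (n + toℕ i)) ≡ + D × (∀ i → ∣ δ i ∣ ≤ A * 2 ^ n)
  residue n {D} Q∣D D<Qc = δ , value , bound
    where
    X : Expansion (M n) k′ D
    X = expansion k′ (M n) {{λ {e} → M-nonZero {n} {e}}} (M₀∣M n) (subst (ℕ∣._∣ D) (sym (M₀ n)) Q∣D)
    t : ℕ → ℕ
    t = Expansion.digit X
    C : ℕ → ℤ
    C i = + c k (n + i)
    δ : Fin K → ℤ
    δ i = ∑[ e < k ] (+ t (toℕ e) *ᶻ μ (toℕ e) i)
    value : ∑[ i < K ] (δ i *ᶻ C (toℕ i)) ≡ + D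
    value = begin
      ∑[ i < K ] (δ i *ᶻ C (toℕ i))
        ≡⟨ ℤΣ.sum-cong-≗ {K} (λ i → ℤΣ.*-distribʳ-sum {k} (C (toℕ i)) (λ e → + t (toℕ e) *ᶻ μ (toℕ e) i)) ⟩
      ∑[ i < K ] ∑[ e < k ] (+ t (toℕ e) *ᶻ μ (toℕ e) i *ᶻ C (toℕ i))
        ≡⟨ ℤΣ.∑-comm {K} {k} (λ i e → + t (toℕ e) *ᶻ μ (toℕ e) i *ᶻ C (toℕ i)) ⟩
      ∑[ e < k ] ∑[ i < K ] (+ t (toℕ e) *ᶻ μ (toℕ e) i *ᶻ C (toℕ i))
        ≡⟨ ℤΣ.sum-cong-≗ {k} (λ e → trans (ℤΣ.sum-cong-≗ {K} (λ i → ℤ.*-assoc (+ t (toℕ e)) (μ (toℕ e) i) (C (toℕ i))))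
                                          (sym (ℤΣ.*-distribˡ-sum {K} (+ t (toℕ e)) (λ i → μ (toℕ e) i *ᶻ C (toℕ i))))) ⟩
      ∑[ e < k ] (+ t (toℕ e) *ᶻ ∑[ i < K ] (μ (toℕ e) i *ᶻ C (toℕ i)))
        ≡⟨ ℤΣ.sum-cong-≗ {k} (λ e → trans (cong (+ t (toℕ e) *ᶻ_) (μ-value n (toℕ e) (toℕ<n e)))
                                          (sym (ℤ.pos-* (t (toℕ e)) (M n (toℕ e))))) ⟩
      ∑[ e < k ] (+ (t (toℕ e) * M n (toℕ e)))
        ≡⟨ pos-∑ {k} (λ e → t (toℕ e) * M n (toℕ e)) ⟨
      + ∑ℕ[ e < k ] (t (toℕ e) * M n (toℕ e))
        ≡⟨ cong +_ (Expansion.sum-digits X) ⟨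
      + D ∎
      where open ≡-Reasoning
    bound : ∀ i → ∣ δ i ∣ ≤ A * 2 ^ n
    bound i = begin
      ∣ δ i ∣
        ≤⟨ ∣∑∣≤∑∣∣ {k} (λ e → + t (toℕ e) *ᶻ μ (toℕ e) i) ⟩
      ∑ℕ[ e < k ] ∣ + t (toℕ e) *ᶻ μ (toℕ e) i ∣
        ≡⟨ ℕΣ.sum-cong-≗ {k} (λ e → ℤ.abs-* (+ t (toℕ e)) (μ (toℕ e) i)) ⟩
      ∑ℕ[ e < k ] (t (toℕ e) * ∣ μ (toℕ e) i ∣)
        ≤⟨ ∑-mono-≤ (λ e → *-monoˡ-≤ ∣ μ (toℕ e) i ∣ (digit≤ n D<Qc X (toℕ e) (toℕ<n e))) ⟩
      ∑ℕ[ e < k ] (H * 2 ^ n * ∣ μ (toℕ e) i ∣)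
        ≡⟨ ℕΣ.*-distribˡ-sum {k} (H * 2 ^ n) (λ e → ∣ μ (toℕ e) i ∣) ⟨
      H * 2 ^ n * ∑ℕ[ e < k ] ∣ μ (toℕ e) i ∣
        ≤⟨ *-monoʳ-≤ (H * 2 ^ n) (≤-∑ (λ i → ∑ℕ[ e < k ] ∣ μ (toℕ e) i ∣) i) ⟩
      H * 2 ^ n * Cμ
        ≡⟨ lemma H (2 ^ n) Cμ ⟩
      A * 2 ^ n ∎
      where
      open ≤-Reasoning
      lemma : ∀ a x b → a * x * b ≡ a * b * x
      lemma = solve-∀

  T₀ Y : ℕ
  T₀ = (Q * suc A * 2 ^ K + Q) * 2 ^ (K * k)
  Y = K * T₀

  J : ℕ → ℕ
  J Z = 2 * (Q * suc A) + 2 * Z + Q + 2 * A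

  module Level {Z : ℕ} (n′ : ℕ) (Q∣2ⁿ-1 : + Q ℤ∣.∣ + 2 ^ suc n′ -ᶻ 1ℤ) {N : ℕ} (E∣N : E k ℕ∣.∣ N)
               (Y2ⁿc≤N : Y * 2 ^ suc n′ * c k (suc n′) ≤ N) (N≤Z2ⁿc : N ≤ Z * 2 ^ suc n′ * c k (suc n′)) where
    open Congruences
    open RepunitCongruences using (c-cong; +c-zero; c-one)
    import Relation.Binary.Reasoning.Setoid as ≈-Reasoning

    n : ℕ
    n = suc n′

    C : Fin K → ℤ
    C i = + c k (n + toℕ i)

    C≡c : ∀ i → C i ≡ + c k (toℕ i) [mod + Q ]
    C≡c i = c-cong k {+ Q} {n + toℕ i} {toℕ i} (begin
      + 2 ^ (n + toℕ i)               ≡⟨ cong +_ (^-distribˡ-+-* 2 n (toℕ i)) ⟩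
      + (2 ^ n * 2 ^ toℕ i)           ≡⟨ ℤ.pos-* (2 ^ n) (2 ^ toℕ i) ⟩
      + 2 ^ n *ᶻ + 2 ^ toℕ i          ≈⟨ ≡-mod-* {a = + 2 ^ n} {1ℤ} (mod-via Q∣2ⁿ-1) (≡-mod-reflexive {a = + 2 ^ toℕ i} refl) ⟩
      1ℤ *ᶻ + 2 ^ toℕ i               ≡⟨ ℤ.*-identityˡ _ ⟩
      + 2 ^ toℕ i                     ∎)
      where open ≈-Reasoning (≡-mod-setoid (+ Q))

    q : ℕ
    q = ℕ∣.quotient E∣N

    α β : ℤ
    α = proj₁ (Divisibility.bézout (2 ^ k ∸ 1) k)
    β = proj₁ (proj₂ (Divisibility.bézout (2 ^ k ∸ 1) k))

    -- Residues making Σ ε i c k (n + i) ≡ q (β k + α (2^k - 1)) = q E k ≡ N (mod Q).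
    ε : Fin K → ℕ
    ε zero = (+ q *ᶻ β) ℤ.%ℕ Q
    ε (suc zero) = (+ q *ᶻ α) ℤ.%ℕ Q
    ε (suc (suc _)) = 0

    ε<Q : ∀ i → ε i < Q
    ε<Q zero = Data.Integer.DivMod.n%ℕd<d (+ q *ᶻ β) Q
    ε<Q (suc zero) = Data.Integer.DivMod.n%ℕd<d (+ q *ᶻ α) Q
    ε<Q (suc (suc _)) = ∣G∣>0 0

    ε-congruence : ∑[ i < K ] (+ ε i *ᶻ C i) ≡ + N [mod + Q ]
    ε-congruence = begin
      + ε zero *ᶻ C zero +ᶻ (+ ε (suc zero) *ᶻ C (suc zero) +ᶻ ∑[ i < k′ ] (0ℤ *ᶻ C (suc (suc i))))
        ≈⟨ ≡-mod-+ (≡-mod-* (%ℕ-≡-mod (+ q *ᶻ β) Q) c₀)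
                   (≡-mod-+ (≡-mod-* (%ℕ-≡-mod (+ q *ᶻ α) Q) c₁) (≡-mod-reflexive zeros)) ⟩
      + q *ᶻ β *ᶻ + k +ᶻ (+ q *ᶻ α *ᶻ + (2 ^ k ∸ 1) +ᶻ 0ℤ)
        ≡⟨ lemma (+ q) α β (+ (2 ^ k ∸ 1)) (+ k) ⟩
      + q *ᶻ (α *ᶻ + (2 ^ k ∸ 1) +ᶻ β *ᶻ + k)
        ≡⟨ cong (+ q *ᶻ_) (proj₂ (proj₂ (Divisibility.bézout (2 ^ k ∸ 1) k))) ⟨
      + q *ᶻ + E k
        ≡⟨ trans (cong +_ (ℕ∣._∣_.equality E∣N)) (ℤ.pos-* q (E k)) ⟨
      + N ∎
      where
      open ≈-Reasoning (≡-mod-setoid (+ Q))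
      c₀ : C zero ≡ + k [mod + Q ]
      c₀ = ≡-mod-trans (C≡c zero) (≡-mod-reflexive (+c-zero k))
      c₁ : C (suc zero) ≡ + (2 ^ k ∸ 1) [mod + Q ]
      c₁ = ≡-mod-trans (C≡c (suc zero)) (≡-mod-reflexive (trans (c-one k) (sym (Divisibility.pos-∸1 (m^n>0 2 k)))))
      zeros : ∑[ i < k′ ] (0ℤ *ᶻ C (suc (suc i))) ≡ 0ℤ
      zeros = trans (ℤΣ.sum-cong-≗ {k′} (λ i → ℤ.*-zeroˡ (C (suc (suc i))))) (ℤΣ.sum-replicate-zero k′)
      lemma : ∀ q α β t k → q *ᶻ β *ᶻ k +ᶻ (q *ᶻ α *ᶻ t +ᶻ 0ℤ) ≡ q *ᶻ (α *ᶻ t +ᶻ β *ᶻ k)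
      lemma = ℤSolver.solve-∀

    bonus : ℕ → Fin K → ℕ
    bonus u zero = u
    bonus u (suc _) = 0

    bonus-zero : ∀ i → bonus 0 i ≡ 0
    bonus-zero zero = refl
    bonus-zero (suc i) = refl

    base : ℕ → Fin K → ℕ
    base u i = Q * (suc A * 2 ^ (n + toℕ i) + bonus u i) + ε i

    V : ℕ → ℕ
    V u = ∑ℕ[ i < K ] (base u i * c k (n + toℕ i))

    V-bonus : ∀ u → V u ≡ V 0 + u * (Q * c k n)
    V-bonus u = trans (lemma Q (suc A * 2 ^ (n + 0)) u (ε zero) (c k (n + 0)) (∑ℕ[ i < k ] (base u (suc i) * c k (n + suc (toℕ i)))))
                      (cong (λ m → V 0 + u * (Q * c k m)) (+-identityʳ n))
      where
      lemma : ∀ q a u e x r → (q * (a + u) + e) * x + r ≡ (q * (a + 0) + e) * x + r + u * (q * x)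
      lemma = solve-∀

    V≡N : ∀ u → + V u ≡ + N [mod + Q ]
    V≡N u = begin
      + V u                                  ≡⟨ pos-∑ {K} (λ i → base u i * c k (n + toℕ i)) ⟩
      ∑[ i < K ] (+ (base u i * c k (n + toℕ i)))
        ≡⟨ ℤΣ.sum-cong-≗ {K} (λ i → ℤ.pos-* (base u i) (c k (n + toℕ i))) ⟩
      ∑[ i < K ] (+ base u i *ᶻ C i)         ≈⟨ ∑-≡-mod (λ i → ≡-mod-* (base≡ε i) (≡-mod-reflexive {a = C i} refl)) ⟩
      ∑[ i < K ] (+ ε i *ᶻ C i)              ≈⟨ ε-congruence ⟩
      + N                                    ∎
      where
      open ≈-Reasoning (≡-mod-setoid (+ Q))
      base≡ε : ∀ i → + base u i ≡ + ε i [mod + Q ]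
      base≡ε i = mod-via (ℤ∣.divides (+ (suc A * 2 ^ (n + toℕ i) + bonus u i))
        (trans (cong (_-ᶻ + ε i) (trans (ℤ.pos-+ (Q * _) (ε i)) (cong (_+ᶻ + ε i) (ℤ.pos-* Q _))))
               (lemma (+ Q) (+ (suc A * 2 ^ (n + toℕ i) + bonus u i)) (+ ε i))))
        where
        lemma : ∀ q w e → q *ᶻ w +ᶻ e -ᶻ e ≡ w *ᶻ q
        lemma = ℤSolver.solve-∀

    V₀≤N : V 0 ≤ N
    V₀≤N = begin
      V 0                                    ≤⟨ ∑-≤-* term≤ ⟩
      K * (T₀ * 2 ^ n * c k n)               ≡⟨ lemma K T₀ (2 ^ n) (c k n) ⟩
      Y * 2 ^ n * c k n                      ≤⟨ Y2ⁿc≤N ⟩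
      N                                      ∎
      where
      open ≤-Reasoning
      lemma : ∀ a b x y → a * (b * x * y) ≡ a * b * x * y
      lemma = solve-∀
      term≤ : ∀ i → base 0 i * c k (n + toℕ i) ≤ T₀ * 2 ^ n * c k n
      term≤ i = begin
        base 0 i * c k (n + toℕ i)
          ≡⟨ cong (λ b → (Q * (suc A * 2 ^ (n + toℕ i) + b) + ε i) * c k (n + toℕ i)) (bonus-zero i) ⟩
        (Q * (suc A * 2 ^ (n + toℕ i) + 0) + ε i) * c k (n + toℕ i)
          ≤⟨ *-mono-≤ (+-mono-≤ (*-monoʳ-≤ Q (+-monoˡ-≤ 0 (*-monoʳ-≤ (suc A) 2ⁿ⁺ⁱ≤))) ε≤)
                      (≤-trans (Repunits.c-shift k n (toℕ i)) (*-monoˡ-≤ (c k n) (^-monoʳ-≤ 2 (*-monoˡ-≤ k i≤K)))) ⟩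
        (Q * (suc A * (2 ^ n * 2 ^ K) + 0) + Q * 2 ^ n) * (2 ^ (K * k) * c k n)
          ≡⟨ lemma′ Q (suc A) (2 ^ n) (2 ^ K) (2 ^ (K * k)) (c k n) ⟩
        T₀ * 2 ^ n * c k n ∎
        where
        i≤K : toℕ i ≤ K
        i≤K = <⇒≤ (toℕ<n i)
        2ⁿ⁺ⁱ≤ : 2 ^ (n + toℕ i) ≤ 2 ^ n * 2 ^ K
        2ⁿ⁺ⁱ≤ = ≤-trans (≤-reflexive (^-distribˡ-+-* 2 n (toℕ i))) (*-monoʳ-≤ (2 ^ n) (^-monoʳ-≤ 2 i≤K))
        ε≤ : ε i ≤ Q * 2 ^ n
        ε≤ = ≤-trans (<⇒≤ (ε<Q i)) (m≤m*n Q (2 ^ n) {{>-nonZero (m^n>0 2 n)}})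
        lemma′ : ∀ q a x y z w → (q * (a * (x * y) + 0) + q * x) * (z * w) ≡ (q * a * y + q) * z * x * w
        lemma′ = solve-∀

    Qc : ℕ
    Qc = Q * c k n

    instance
      Qc-nonZero : NonZero Qc
      Qc-nonZero = >-nonZero (*-mono-≤ (∣G∣>0 0) (s≤s z≤n))

    u D′ : ℕ
    u = (N ∸ V 0) / Qc
    D′ = (N ∸ V 0) % Qc

    N≡V+D′ : N ≡ V u + D′
    N≡V+D′ = begin-equality
      N                          ≡⟨ m+[n∸m]≡n V₀≤N ⟨
      V 0 + (N ∸ V 0)            ≡⟨ cong (_+_ (V 0)) (m≡m%n+[m/n]*n (N ∸ V 0) Qc) ⟩
      V 0 + (D′ + u * Qc)        ≡⟨ lemma (V 0) D′ (u * Qc) ⟩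
      V 0 + u * Qc + D′          ≡⟨ cong (_+ D′) (V-bonus u) ⟨
      V u + D′                   ∎
      where
      open ≤-Reasoning
      lemma : ∀ a b d → a + (b + d) ≡ a + d + b
      lemma = solve-∀

    Q∣D′ : Q ℕ∣.∣ D′
    Q∣D′ = ℤ∣.∣⇒∣ᵤ (subst (+ Q ℤ∣.∣_) N-V≡D′ (∣-difference (≡-mod-sym (V≡N u))))
      where
      N-V≡D′ : + N -ᶻ + V u ≡ + D′
      N-V≡D′ = trans (cong (λ x → + x -ᶻ + V u) N≡V+D′)
                     (trans (cong (_-ᶻ + V u) (ℤ.pos-+ (V u) D′)) (lemma (+ V u) (+ D′)))
        where
        lemma : ∀ v d → v +ᶻ d -ᶻ v ≡ d
        lemma = ℤSolver.solve-∀

    Qu≤Z2ⁿ : Q * u ≤ Z * 2 ^ n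
    Qu≤Z2ⁿ = *-cancelʳ-≤ (Q * u) (Z * 2 ^ n) (c k n) (begin
      Q * u * c k n           ≡⟨ lemma Q u (c k n) ⟩
      u * Qc                  ≤⟨ m/n*n≤m (N ∸ V 0) Qc ⟩
      N ∸ V 0                 ≤⟨ m∸n≤m N (V 0) ⟩
      N                       ≤⟨ N≤Z2ⁿc ⟩
      Z * 2 ^ n * c k n       ∎)
      where
      open ≤-Reasoning
      lemma : ∀ q u x → q * u * x ≡ u * (q * x)
      lemma = solve-∀

    correction : Σ (Fin K → ℤ) λ δ → ∑[ i < K ] (δ i *ᶻ C i) ≡ + D′ × (∀ i → ∣ δ i ∣ ≤ A * 2 ^ n)
    correction = residue n Q∣D′ (m%n<n (N ∸ V 0) Qc)

    δ : Fin K → ℤ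
    δ = proj₁ correction

    L : Fin K → ℕ
    L i = 2 ^ (n′ + toℕ i)

    ∣δ∣≤ : ∀ i → ∣ δ i ∣ ≤ A * (2 * L i)
    ∣δ∣≤ i = ≤-trans (proj₂ (proj₂ correction) i) (*-monoʳ-≤ A (^-monoʳ-≤ 2 (m≤m+n n (toℕ i))))

    bonus≤ : ∀ i → bonus u i ≤ u
    bonus≤ zero = ≤-refl
    bonus≤ (suc i) = z≤n

    ∣δ∣+L≤base : ∀ i → ∣ δ i ∣ + L i ≤ base u i
    ∣δ∣+L≤base i = begin
      ∣ δ i ∣ + L i                          ≤⟨ +-mono-≤ (∣δ∣≤ i) (m≤m+n (L i) (L i + 0)) ⟩
      A * (2 * L i) + 2 * L i                ≡⟨ +-comm (A * (2 * L i)) (2 * L i) ⟩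
      suc A * (2 * L i)                      ≤⟨ m≤n*m (suc A * (2 * L i)) Q ⟩
      Q * (suc A * (2 * L i))                ≤⟨ *-monoʳ-≤ Q (m≤m+n _ (bonus u i)) ⟩
      Q * (suc A * (2 * L i) + bonus u i)    ≤⟨ m≤m+n _ (ε i) ⟩
      base u i                               ∎
      where open ≤-Reasoning

    base+∣δ∣≤ : ∀ i → base u i + ∣ δ i ∣ ≤ J Z * L i
    base+∣δ∣≤ i = begin
      Q * (suc A * (2 * L i) + bonus u i) + ε i + ∣ δ i ∣
        ≡⟨ cong (λ x → x + ε i + ∣ δ i ∣) (*-distribˡ-+ Q (suc A * (2 * L i)) (bonus u i)) ⟩
      Q * (suc A * (2 * L i)) + Q * bonus u i + ε i + ∣ δ i ∣
        ≤⟨ +-mono-≤ (+-mono-≤ (+-monoʳ-≤ (Q * (suc A * (2 * L i))) Qbonus≤) ε≤) (∣δ∣≤ i) ⟩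
      Q * (suc A * (2 * L i)) + Z * (2 * L i) + Q * L i + A * (2 * L i)
        ≡⟨ lemma Q A Z (L i) ⟩
      J Z * L i ∎
      where
      open ≤-Reasoning
      Qbonus≤ : Q * bonus u i ≤ Z * (2 * L i)
      Qbonus≤ = ≤-trans (*-monoʳ-≤ Q (bonus≤ i)) (≤-trans Qu≤Z2ⁿ (*-monoʳ-≤ Z (^-monoʳ-≤ 2 (m≤m+n n (toℕ i)))))
      ε≤ : ε i ≤ Q * L i
      ε≤ = ≤-trans (<⇒≤ (ε<Q i)) (m≤m*n Q (L i) {{>-nonZero (m^n>0 2 (n′ + toℕ i))}})
      lemma : ∀ q a z l → q * (suc a * (2 * l)) + z * (2 * l) + q * l + a * (2 * l) ≡
                          (2 * (q * suc a) + 2 * z + q + 2 * a) * l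
      lemma = solve-∀

    m : Fin K → ℕ
    m i = ∣ + base u i +ᶻ δ i ∣

    m-bounds : ∀ i → + m i ≡ + base u i +ᶻ δ i × L i ≤ m i × m i ≤ J Z * L i
    m-bounds i = Bounds.perturbation-bounds (base u i) (δ i) (∣δ∣+L≤base i) (base+∣δ∣≤ i)

    ∑m≡N : ∑ℕ[ i < K ] (m i * c k (n + toℕ i)) ≡ N
    ∑m≡N = ℤ.+-injective (begin
      + ∑ℕ[ i < K ] (m i * c k (n + toℕ i))
        ≡⟨ pos-∑ {K} (λ i → m i * c k (n + toℕ i)) ⟩
      ∑[ i < K ] (+ (m i * c k (n + toℕ i)))
        ≡⟨ ℤΣ.sum-cong-≗ {K} (λ i → trans (ℤ.pos-* (m i) _) (cong (_*ᶻ C i) (proj₁ (m-bounds i)))) ⟩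
      ∑[ i < K ] ((+ base u i +ᶻ δ i) *ᶻ C i)
        ≡⟨ ℤΣ.sum-cong-≗ {K} (λ i → ℤ.*-distribʳ-+ (C i) (+ base u i) (δ i)) ⟩
      ∑[ i < K ] (+ base u i *ᶻ C i +ᶻ δ i *ᶻ C i)
        ≡⟨ ℤΣ.∑-distrib-+ {K} (λ i → + base u i *ᶻ C i) (λ i → δ i *ᶻ C i) ⟩
      ∑[ i < K ] (+ base u i *ᶻ C i) +ᶻ ∑[ i < K ] (δ i *ᶻ C i)
        ≡⟨ cong₂ _+ᶻ_ (trans (ℤΣ.sum-cong-≗ {K} (λ i → sym (ℤ.pos-* (base u i) (c k (n + toℕ i)))))
                             (sym (pos-∑ {K} (λ i → base u i * c k (n + toℕ i)))))
                      (proj₁ (proj₂ correction)) ⟩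
      + V u +ᶻ + D′
        ≡⟨ ℤ.pos-+ (V u) D′ ⟨
      + (V u + D′)
        ≡⟨ cong +_ N≡V+D′ ⟨
      + N ∎)
      where open ≡-Reasoning

  representation : ∀ {Z} n′ → + Q ℤ∣.∣ + 2 ^ suc n′ -ᶻ 1ℤ → ∀ {N} → E k ℕ∣.∣ N →
                   Y * 2 ^ suc n′ * c k (suc n′) ≤ N → N ≤ Z * 2 ^ suc n′ * c k (suc n′) →
                   Σ (Fin K → ℕ) λ m → (∀ i → 2 ^ (n′ + toℕ i) ≤ m i × m i ≤ J Z * 2 ^ (n′ + toℕ i)) ×
                                       ∑ℕ[ i < K ] (m i * c k (suc n′ + toℕ i)) ≡ N
  representation {Z} n′ Q∣ E∣N lo hi = m , (λ i → proj₂ (m-bounds i)) , ∑m≡N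
    where open Level {Z} n′ Q∣ E∣N lo hi

  -- Opaque: unfolding d during unification would evaluate the period computation.
  opaque
    d : ℕ
    d = proj₁ Q-period

    1≤d : 1 ≤ d
    1≤d = proj₁ (proj₂ Q-period)

    Q∣2ᵈ-1 : + Q ℤ∣.∣ + 2 ^ d -ᶻ 1ℤ
    Q∣2ᵈ-1 = proj₂ (proj₂ Q-period)

  Z W : ℕ
  Z = Y * 2 ^ (d * K)
  W = K * J Z

  lo hi : ℕ → ℕ
  lo s = Y * 2 ^ (d * s) * c k (d * s)
  hi s = Z * 2 ^ (d * s) * c k (d * s)

  lo-overlaps : ∀ s → lo (suc s) ≤ hi s
  lo-overlaps s = begin
    Y * 2 ^ (d * suc s) * c k (d * suc s)
      ≡⟨ cong (λ x → Y * 2 ^ x * c k x) (trans (*-suc d s) (+-comm d (d * s))) ⟩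
    Y * 2 ^ (d * s + d) * c k (d * s + d)
      ≤⟨ *-monoʳ-≤ (Y * 2 ^ (d * s + d)) (Repunits.c-shift k (d * s) d) ⟩
    Y * 2 ^ (d * s + d) * (2 ^ (d * k) * c k (d * s))
      ≡⟨ cong (λ x → Y * x * (2 ^ (d * k) * c k (d * s))) (^-distribˡ-+-* 2 (d * s) d) ⟩
    Y * (2 ^ (d * s) * 2 ^ d) * (2 ^ (d * k) * c k (d * s))
      ≡⟨ lemma Y (2 ^ (d * s)) (2 ^ d) (2 ^ (d * k)) (c k (d * s)) ⟩
    Y * (2 ^ d * 2 ^ (d * k)) * 2 ^ (d * s) * c k (d * s)
      ≡⟨ cong (λ x → Y * x * 2 ^ (d * s) * c k (d * s)) 2^dK ⟨
    hi s ∎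
    where
    open ≤-Reasoning
    lemma : ∀ y a b e x → y * (a * b) * (e * x) ≡ y * (b * e) * a * x
    lemma = solve-∀
    2^dK : 2 ^ (d * K) ≡ 2 ^ d * 2 ^ (d * k)
    2^dK = trans (cong (2 ^_) (*-suc d k)) (^-distribˡ-+-* 2 d (d * k))

  lo-grows : ∀ s → s < lo s
  lo-grows s = begin-strict
    s                       <⟨ n<2^n s ⟩
    2 ^ s                   ≤⟨ ^-monoʳ-≤ 2 (m≤n*m s d {{>-nonZero 1≤d}}) ⟩
    2 ^ (d * s)             ≤⟨ m≤n*m (2 ^ (d * s)) Y {{>-nonZero Y>0}} ⟩
    Y * 2 ^ (d * s)         ≤⟨ m≤m*n (Y * 2 ^ (d * s)) (c k (d * s)) ⟩
    lo s                    ∎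
    where
    open ≤-Reasoning
    n<2^n : ∀ n → n < 2 ^ n
    n<2^n zero = s≤s z≤n
    n<2^n (suc n) = +-mono-≤ (m^n>0 2 n) (≤-trans (n<2^n n) (m≤m+n (2 ^ n) 0))
    Y>0 : 0 < Y
    Y>0 = *-mono-≤ {1} {K} (s≤s z≤n)
                   (*-mono-≤ (≤-trans (∣G∣>0 0) (m≤n+m Q (Q * suc A * 2 ^ K))) (m^n>0 2 (K * k)))

  sumOfAtMost-atLevel : ∀ n → 1 ≤ n → + Q ℤ∣.∣ + 2 ^ n -ᶻ 1ℤ → ∀ {N} → E k ℕ∣.∣ N →
                        Y * 2 ^ n * c k n ≤ N → N ≤ Z * 2 ^ n * c k n → SumOfAtMost k W N
  sumOfAtMost-atLevel (suc n′) _ Q∣ E∣N lo hi =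
    let m , bounds , ∑≡N = representation {Z} n′ Q∣ E∣N lo hi
    in subst (SumOfAtMost k W) ∑≡N
         (SumsOfBinaryPowers.sumOfAtMost-∑ k K (λ i → m i * c k (suc n′ + toℕ i))
           λ i → SumsOfBinaryPowers.sumOfAtMost-level k (J Z) (n′ + toℕ i)
                                                       (proj₁ (bounds i)) (proj₂ (bounds i)))

  sumOfAtMost : ∀ {N} → E k ℕ∣.∣ N → lo 1 < N → SumOfAtMost k W N
  sumOfAtMost {N} E∣N lo₁<N =
    let s , 1≤s , lo≤N , N≤hi = Bounds.covering lo hi lo-overlaps lo-grows (<⇒≤ lo₁<N)
    in sumOfAtMost-atLevel (d * s) (*-mono-≤ 1≤d 1≤s) (Divisibility.∣2^-pred⇒∣2^*-pred d s Q∣2ᵈ-1)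
                           {N} E∣N lo≤N N≤hi

  1≤W : 1 ≤ W
  1≤W = *-mono-≤ {1} {K} (s≤s z≤n)
                 (≤-trans (∣G∣>0 0) (≤-trans (m≤n+m Q (2 * (Q * suc A) + 2 * Z)) (m≤m+n _ (2 * A))))

open import Data.Nat using (ℕ; suc; _≤_; _<_)
open import Data.Nat.Divisibility using (_∣_)
open import Data.Product using (Σ; _×_; _,_)

theorem4 : (k : ℕ) → 1 ≤ k →
    Σ ℕ λ W → Σ ℕ λ N₀ → 1 ≤ W ×
      ((N : ℕ) → E k ∣ N → N₀ < N → SumOfAtMost k W N)
theorem4 (suc k′) _ = W , lo 1 , 1≤W , λ N → sumOfAtMost
  where open Construction k′
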